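{- For all belief functions $f,g\in\mathcal{F}$, we have $f\preceq g$ if and only if $\vec{f}\le\vec{g}$, where $\le$ is the componentwise (product) order on $\mathbb{Z}^{|Q|+2}$.
   Context: Let $Q$ be a non-empty finite set of states. The belief functions are $\mathcal{F}=\{f:Q\to\mathbb{Z}\cup\{\bot\}\}$, and the support of $f$ is $\mathsf{supp}(f)=\{q\mid f(q)\ne\bot\}$. For $f,g\in\mathcal{F}$, write $f\preceq g$ iff $\mathsf{supp}(f)=\mathsf{supp}(g)$ and $f(q)\le g(q)$ for all $q\in\mathsf{supp}(f)$. Fix bijections $\alpha:\{1,\dots,|Q|\}\to Q$ and $\beta:2^Q\to\{1,\dots,2^{|Q|}\}$. For $f\in\mathcal{F}$, define $\gamma_f(q)=f(q)$ if $q\in\mathsf{supp}(f)$, and $\gamma_f(q)=\min\{f(p)\mid p\in\mathsf{supp}(f)\}$ otherwise. The vector of $f$ is $\vec f=(2^{|Q|}-\beta(\mathsf{supp}(f)),\ \beta(\mathsf{supp}(f)),\ \gamma_f(\alpha(|Q|)),\dots,\gamma_f(\alpha(1)))\in\mathbb{Z}^{|Q|+2}$. -}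

module Defs where

open import Data.Nat using (ℕ; suc; _^_)
open import Data.Integer using (ℤ; +_; _-_; _≤_; _⊓_)
open import Data.Fin using (Fin; toℕ; opposite)
open import Data.Fin.Subset using (Subset)
open import Data.Maybe using (Maybe; just; nothing; is-just)
open import Data.List using (List; []; _∷_; foldr; allFin; mapMaybe)
open import Data.Vec using (Vec; _∷_; tabulate)
open import Data.Product using (_×_)
open import Data.Unit using (⊤)
open import Function.Bundles using (_⤖_; Bijection)
open import Relation.Binary.PropositionalEquality using (_≡_)

-- The state set Q is modelled as Fin n (n = |Q|); ⊥ is modelled as nothing.
Belief : ℕ → Set
Belief n = Fin n → Maybe ℤ

supp : ∀ {n} → Belief n → Subset n
supp f = tabulate (λ q → is-just (f q))

-- pointwise comparison of values; only relevant on the (common) support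
leqVal : Maybe ℤ → Maybe ℤ → Set
leqVal (just a) (just b) = a ≤ b
leqVal _ _ = ⊤

_⪯_ : ∀ {n} → Belief n → Belief n → Set
f ⪯ g = (supp f ≡ supp g) × (∀ q → leqVal (f q) (g q))

suppValues : ∀ {n} → Belief n → List ℤ
suppValues {n} f = mapMaybe f (allFin n)

-- min over the support (convention: 0 if the support is empty, where the
-- paper's min is undefined)
minSupp : ∀ {n} → Belief n → ℤ
minSupp f with suppValues f
... | [] = + 0
... | x ∷ xs = foldr _⊓_ x xs

γ : ∀ {n} → Belief n → Fin n → ℤ
γ f q with f q
... | just a = a
... | nothing = minSupp f

-- β is given with codomain Fin (2^n); the paper's value β(S) ∈ {1..2^n}
-- is toℕ (Bijection.to β S) + 1.
βval : ∀ {n} → (Subset n ⤖ Fin (2 ^ n)) → Subset n → ℤ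
βval β S = + suc (toℕ (Bijection.to β S))

-- α is given as a bijection Fin n → Q (= Fin n); the paper's α(i), i ∈ {1..n},
-- is Bijection.to α (i-1).  Component 2+j (j = 0..n-1) is γ_f(α(n - j)).
vec : ∀ {n} → (Fin n ⤖ Fin n) → (Subset n ⤖ Fin (2 ^ n)) → Belief n → Vec ℤ (2 Data.Nat.+ n)
vec {n} α β f =
  ((+ (2 ^ n)) - βval β (supp f)) ∷ βval β (supp f) ∷
  tabulate (λ j → γ f (Bijection.to α (opposite j)))

-- The first two coordinates of the vector are 2^|Q| - β(supp f) and β(supp f),
-- so both are ≤ exactly when β(supp f) = β(supp g), i.e. when the supports
-- agree.  Given equal supports, γ_f and γ_g agree with f and g on the support
-- and are the constant minima off it; the minimum is monotone, so f ⪯ g iff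
-- γ_f ≤ γ_g pointwise, and these are the remaining coordinates up to the
-- reindexing by α, which is onto.
module Submission where

open import Defs
open import Data.Nat using (ℕ; suc; _^_)
open import Data.Integer using (_≤_)
open import Data.Fin using (Fin)
open import Data.Fin.Subset using (Subset)
open import Data.Vec.Relation.Binary.Pointwise.Inductive using (Pointwise)
open import Function.Bundles using (_⤖_; _⇔_)

open import Algebra.Bundles using (AbelianGroup)
open import Data.Integer using (+_; -_; _-_)
open import Data.Integer.Properties
  using (≤-refl; ≤-reflexive; ≤-antisym; ⊓-mono-≤; +-monoʳ-≤; neg-cancel-≤; +-0-abelianGroup; +-injective)
open import Algebra.Properties.Group (AbelianGroup.group +-0-abelianGroup) using (\\-leftDividesʳ)
open import Data.Nat.Properties using (suc-injective)
open import Data.Fin using (opposite)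
open import Data.Fin.Properties using (toℕ-injective; opposite-involutive)
open import Data.List using ([]; _∷_; allFin; mapMaybe)
import Data.List.Relation.Binary.Pointwise as List
open import Data.Maybe using (Maybe; just; nothing; is-just)
import Data.Maybe.Relation.Binary.Pointwise as Maybe
open import Data.Product using (_,_)
open import Data.Unit using (tt)
open import Data.Vec using (lookup)
open import Data.Vec.Properties using (lookup∘tabulate)
import Data.Vec.Relation.Binary.Pointwise.Inductive as Vec
open import Function.Base using (_∘_)
open import Function.Bundles using (Bijection; mk⇔)
open import Level using (Level)
open import Relation.Binary.Core using (REL)
open import Relation.Binary.PropositionalEquality using (_≡_; refl; cong; subst; subst₂; module ≡-Reasoning)

private
  variable
    a b c r : Level
    A : Set a
    B : Set b
    C : Set c
    n : ℕ

mapMaybe⁺ : {R : REL A B r} {f : C → Maybe A} {g : C → Maybe B} →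
            (∀ x → Maybe.Pointwise R (f x) (g x)) →
            ∀ xs → List.Pointwise R (mapMaybe f xs) (mapMaybe g xs)
mapMaybe⁺ f~g [] = List.[]
mapMaybe⁺ {f = f} {g} f~g (x ∷ xs) with f x | g x | f~g x
... | just _  | just _  | Maybe.just fx~gx = fx~gx List.∷ mapMaybe⁺ f~g xs
... | nothing | nothing | Maybe.nothing    = mapMaybe⁺ f~g xs

_≤ᴮ_ : Belief n → Belief n → Set
f ≤ᴮ g = ∀ q → Maybe.Pointwise _≤_ (f q) (g q)

supp-≡⇒is-just-≡ : {f g : Belief n} → supp f ≡ supp g → ∀ q → is-just (f q) ≡ is-just (g q)
supp-≡⇒is-just-≡ {f = f} {g} supp≡ q = begin
  is-just (f q)         ≡⟨ lookup∘tabulate (λ p → is-just (f p)) q ⟨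
  lookup (supp f) q     ≡⟨ cong (λ S → lookup S q) supp≡ ⟩
  lookup (supp g) q     ≡⟨ lookup∘tabulate (λ p → is-just (g p)) q ⟩
  is-just (g q)         ∎
  where open ≡-Reasoning

⪯⇒≤ᴮ : {f g : Belief n} → f ⪯ g → f ≤ᴮ g
⪯⇒≤ᴮ {f = f} {g} (supp≡ , f≤g) q with f q | g q | f≤g q | supp-≡⇒is-just-≡ supp≡ q
... | just _  | just _  | fq≤gq | _ = Maybe.just fq≤gq
... | nothing | nothing | _     | _ = Maybe.nothing
... | just _  | nothing | _     | ()
... | nothing | just _  | _     | ()

minSupp-mono : {f g : Belief n} → f ≤ᴮ g → minSupp f ≤ minSupp g
minSupp-mono {n} {f} {g} f≤g with suppValues f | suppValues g | mapMaybe⁺ f≤g (allFin n)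
... | []    | []    | List.[]           = ≤-refl
... | _ ∷ _ | _ ∷ _ | x≤y List.∷ xs≤ys = List.foldr⁺ ⊓-mono-≤ x≤y xs≤ys

γ-mono : {f g : Belief n} → f ≤ᴮ g → ∀ q → γ f q ≤ γ g q
γ-mono {f = f} {g} f≤g q with f q | g q | f≤g q
... | just _  | just _  | Maybe.just fq≤gq = fq≤gq
... | nothing | nothing | Maybe.nothing    = minSupp-mono f≤g

γ-≤⇒leqVal : {f g : Belief n} → (∀ q → γ f q ≤ γ g q) → ∀ q → leqVal (f q) (g q)
γ-≤⇒leqVal {f = f} {g} γ≤ q with f q | g q | γ≤ q
... | just _  | just _  | fq≤gq = fq≤gq
... | just _  | nothing | _     = tt
... | nothing | _       | _     = tt

βval-injective : (β : Subset n ⤖ Fin (2 ^ n)) {S T : Subset n} → βval β S ≡ βval β T → S ≡ T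
βval-injective β = Bijection.injective β ∘ toℕ-injective ∘ suc-injective ∘ +-injective

i-j≤i-k⇒k≤j : ∀ i {j k} → i - j ≤ i - k → k ≤ j
i-j≤i-k⇒k≤j i {j} {k} i-j≤i-k =
  -- add -i on the left; \\-leftDividesʳ i x : - i + (i + x) ≡ x
  neg-cancel-≤ (subst₂ _≤_ (\\-leftDividesʳ i (- j)) (\\-leftDividesʳ i (- k)) (+-monoʳ-≤ (- i) i-j≤i-k))

∀-opposite-bijection : (α : Fin n ⤖ Fin n) {P : Fin n → Set} →
                       (∀ j → P (Bijection.to α (opposite j))) → ∀ q → P q
∀-opposite-bijection α {P} Pα q with Bijection.strictlySurjective α q
... | i , refl = subst (P ∘ Bijection.to α) (opposite-involutive i) (Pα (opposite i))

lemma2 : (k : ℕ) → (α : Fin (suc k) ⤖ Fin (suc k)) → (β : Subset (suc k) ⤖ Fin (2 ^ suc k))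
    → (f g : Belief (suc k))
    → (f ⪯ g) ⇔ Pointwise _≤_ (vec α β f) (vec α β g)
lemma2 k α β f g = mk⇔ forward backward
  where
  forward : f ⪯ g → Pointwise _≤_ (vec α β f) (vec α β g)
  forward f⪯g@(supp≡ , _) =
    ≤-reflexive (cong (λ S → + 2 ^ suc k - βval β S) supp≡) Vec.∷
    ≤-reflexive (cong (βval β) supp≡) Vec.∷
    Vec.tabulate⁺ (γ-mono (⪯⇒≤ᴮ f⪯g) ∘ Bijection.to α ∘ opposite)

  backward : Pointwise _≤_ (vec α β f) (vec α β g) → f ⪯ g
  backward (c-βf≤c-βg Vec.∷ βf≤βg Vec.∷ γf≤γg) =
    βval-injective β (≤-antisym βf≤βg (i-j≤i-k⇒k≤j (+ 2 ^ suc k) c-βf≤c-βg)) ,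
    γ-≤⇒leqVal (∀-opposite-bijection α (Vec.tabulate⁻ γf≤γg))
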